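{- Let $a,b,p,q$ be complex numbers with $p\neq 0$, $q\neq 0$. For every integer $m$, every non-negative integer $k$, and every integer $r$ with $w_{r-1}\neq 0$, \[ \sum_{j=0}^k \left(\frac{w_r}{qw_{r-1}}\right)^j w_{m+r-k+j} = \left(\frac{w_r}{qw_{r-1}}\right)^k u_m w_r - q u_{m-k-1} w_{r-1}. \]
   Context: The sequence $\{w_n\}=\{w_n(a,b;p,q)\}$ is defined by $w_0=a$, $w_1=b$, $w_n=pw_{n-1}-qw_{n-2}$ for $n\ge 2$, and extended to negative indices by $w_{ -n}=(pw_{ -n+1}-w_{ -n+2})/q$, so that $w_n=pw_{n-1}-qw_{n-2}$ holds for all integers $n$. The sequence $u_n=u_n(p,q)$ is $w_n(1,p;p,q)$, i.e. $u_0=1$, $u_1=p$, $u_n=pu_{n-1}-qu_{n-2}$ for all integers $n$ (with the same parameters $p,q$). -}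

module Defs where

open import Level using (Level; _⊔_) renaming (suc to lsuc)
open import Algebra.Bundles using (CommutativeRing)
open import Data.Nat using (ℕ; zero; suc)
open import Data.Integer using (ℤ; +_; -[1+_])
open import Data.Product using (_×_; _,_; proj₁)
open import Relation.Nullary using (¬_)

-- A field: a commutative ring with 0 ≠ 1 and a (total) inversion
-- operation that is a two-sided inverse on every nonzero element.
-- (The value of 0⁻¹ is irrelevant/unspecified.)
record Field (c ℓ : Level) : Set (lsuc (c ⊔ ℓ)) where
  field
    commutativeRing : CommutativeRing c ℓ
  open CommutativeRing commutativeRing public
  field
    _⁻¹       : Carrier → Carrier
    0≉1       : ¬ (0# ≈ 1#)
    ⁻¹-inverse : ∀ x → ¬ (x ≈ 0#) → x * (x ⁻¹) ≈ 1#

  _/_ : Carrier → Carrier → Carrier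
  x / y = x * (y ⁻¹)

  pow : Carrier → ℕ → Carrier
  pow x zero    = 1#
  pow x (suc n) = pow x n * x

  sumTo : ℕ → (ℕ → Carrier) → Carrier
  sumTo zero    f = f 0
  sumTo (suc k) f = sumTo k f + f (suc k)

  -- (w_n, w_{n+1}) for n ≥ 0
  wFwd : Carrier → Carrier → Carrier → Carrier → ℕ → Carrier × Carrier
  wFwd a b p q zero = (a , b)
  wFwd a b p q (suc n) with wFwd a b p q n
  ... | (x , y) = (y , p * y - q * x)

  -- (w_{-n}, w_{-n+1}) for n ≥ 0, using w_{-n} = (p w_{-n+1} - w_{-n+2}) / q
  wBwd : Carrier → Carrier → Carrier → Carrier → ℕ → Carrier × Carrier
  wBwd a b p q zero = (a , b)
  wBwd a b p q (suc n) with wBwd a b p q n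
  ... | (x , y) = ((p * x - y) / q , x)

  w : Carrier → Carrier → Carrier → Carrier → ℤ → Carrier
  w a b p q (+ n)      = proj₁ (wFwd a b p q n)
  w a b p q -[1+ n ]   = proj₁ (wBwd a b p q (suc n))

  u : Carrier → Carrier → ℤ → Carrier
  u p q = w 1# p p q

-- The Horadam sequence w satisfies w_{n+2} = p w_{n+1} - q w_n at every integer n, and for
-- q ≠ 0 a solution of this recurrence is determined by two consecutive values. As functions
-- of m, both sides of w_{m+n} = u_m w_n - q u_{m-1} w_{n-1} are solutions agreeing at
-- m = 0, 1, which gives this addition formula. The sum is then evaluated by induction on k
-- (for all m at once): the new top term x^{k+1} w_{m+r}, expanded by the addition formula,
-- contributes -x^{k+1} q u_{m-1} w_{r-1}, which cancels x^k u_{m-1} w_r because x q w_{r-1} = w_r.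

module Submission where

open import Defs
open import Data.Nat using (ℕ; zero; suc)
open import Data.Integer using (ℤ; +_; -[1+_]; _⊖_) renaming (_+_ to _+ℤ_; _-_ to _-ℤ_)
open import Relation.Nullary using (¬_; yes; no)

open import Algebra.Bundles using (CommutativeRing)
open import Algebra.Solver.Ring.AlmostCommutativeRing
  using (_-Raw-AlmostCommutative⟶_; fromCommutativeRing; Induced-equivalence)
import Data.Integer as ℤ
import Data.Integer.Properties as ℤ
open import Data.Integer.Tactic.RingSolver using (solve-∀)
open import Data.Maybe using (just; nothing)
import Data.Nat as ℕ
import Data.Nat.Properties as ℕ
import Data.Sign as Sign
open import Relation.Binary.Definitions using (WeaklyDecidable)
open import Relation.Binary.PropositionalEquality using (_≡_; cong; subst)
open import Algebra.Properties.CommutativeSemigroup ℤ.+-commutativeSemigroup using (xy∙z≈xz∙y)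

-- The ring solver needs a coefficient ring whose equality it can decide; the canonical map
-- ℤ → R provides one for every commutative ring R.
module IntegerCoefficientSolver {c ℓ} (R : CommutativeRing c ℓ) where
  open CommutativeRing R
  open import Algebra.Properties.Ring ring
    using (-‿distribˡ-*; -‿distribʳ-*; -‿involutive; -0#≈0#; -‿+-comm; xyx⁻¹≈y)
  open import Algebra.Properties.Semiring.Mult.TCOptimised semiring
    using (_×_; ×-homo-+; ×1-homo-*)
  open import Relation.Binary.Reasoning.Setoid setoid

  ⟦_⟧ℤ : ℤ → Carrier
  ⟦ + n ⟧ℤ      = n × 1#
  ⟦ -[1+ n ] ⟧ℤ = - (suc n × 1#)

  private
    -x*-y≈x*y : ∀ x y → - x * - y ≈ x * y
    -x*-y≈x*y x y = begin
      - x * - y     ≈⟨ -‿distribˡ-* x (- y) ⟨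
      - (x * - y)   ≈⟨ -‿cong (-‿distribʳ-* x y) ⟨
      - - (x * y)   ≈⟨ -‿involutive (x * y) ⟩
      x * y         ∎

    [z+x]-[z+y]≈x-y : ∀ x y z → (z + x) - (z + y) ≈ x - y
    [z+x]-[z+y]≈x-y x y z = begin
      (z + x) + - (z + y)      ≈⟨ +-congˡ (-‿+-comm z y) ⟨
      (z + x) + (- z + - y)    ≈⟨ +-assoc (z + x) (- z) (- y) ⟨
      (z + x + - z) + - y      ≈⟨ +-congʳ (xyx⁻¹≈y z x) ⟩
      x - y                    ∎

    ⊖-homo : ∀ m n → ⟦ m ⊖ n ⟧ℤ ≈ m × 1# - n × 1#
    ⊖-homo zero    zero    = sym (-‿inverseʳ 0#)
    ⊖-homo zero    (suc n) = sym (+-identityˡ _)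
    ⊖-homo (suc m) zero    = sym (trans (+-congˡ -0#≈0#) (+-identityʳ _))
    ⊖-homo (suc m) (suc n) = begin
      ⟦ suc m ⊖ suc n ⟧ℤ               ≡⟨ cong ⟦_⟧ℤ (ℤ.[1+m]⊖[1+n]≡m⊖n m n) ⟩
      ⟦ m ⊖ n ⟧ℤ                       ≈⟨ ⊖-homo m n ⟩
      m × 1# - n × 1#                  ≈⟨ [z+x]-[z+y]≈x-y _ _ 1# ⟨
      (1# + m × 1#) - (1# + n × 1#)    ≈⟨ +-cong (×-homo-+ 1# 1 m) (-‿cong (×-homo-+ 1# 1 n)) ⟨
      suc m × 1# - suc n × 1#          ∎

    +◃-homo : ∀ n → ⟦ Sign.+ ℤ.◃ n ⟧ℤ ≈ n × 1#
    +◃-homo zero    = refl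
    +◃-homo (suc n) = refl

    -◃-homo : ∀ n → ⟦ Sign.- ℤ.◃ n ⟧ℤ ≈ - (n × 1#)
    -◃-homo zero    = sym -0#≈0#
    -◃-homo (suc n) = refl

    +-homo : ∀ i j → ⟦ i ℤ.+ j ⟧ℤ ≈ ⟦ i ⟧ℤ + ⟦ j ⟧ℤ
    +-homo (+ m)    (+ n)    = ×-homo-+ 1# m n
    +-homo (+ m)    -[1+ n ] = ⊖-homo m (suc n)
    +-homo -[1+ m ] (+ n)    = trans (⊖-homo n (suc m)) (+-comm _ _)
    +-homo -[1+ m ] -[1+ n ] = begin
      - (suc (suc m ℕ.+ n) × 1#)          ≡⟨ cong (λ k → - (suc k × 1#)) (ℕ.+-suc m n) ⟨
      - ((suc m ℕ.+ suc n) × 1#)          ≈⟨ -‿cong (×-homo-+ 1# (suc m) (suc n)) ⟩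
      - (suc m × 1# + suc n × 1#)         ≈⟨ -‿+-comm _ _ ⟨
      - (suc m × 1#) + - (suc n × 1#)     ∎

    *-homo : ∀ i j → ⟦ i ℤ.* j ⟧ℤ ≈ ⟦ i ⟧ℤ * ⟦ j ⟧ℤ
    *-homo (+ m) (+ n) =
      trans (+◃-homo (m ℕ.* n)) (×1-homo-* m n)
    *-homo (+ m) -[1+ n ] =
      trans (-◃-homo (m ℕ.* suc n)) (trans (-‿cong (×1-homo-* m (suc n))) (-‿distribʳ-* _ _))
    *-homo -[1+ m ] (+ n) =
      trans (-◃-homo (suc m ℕ.* n)) (trans (-‿cong (×1-homo-* (suc m) n)) (-‿distribˡ-* _ _))
    *-homo -[1+ m ] -[1+ n ] =
      trans (+◃-homo (suc m ℕ.* suc n)) (trans (×1-homo-* (suc m) (suc n)) (sym (-x*-y≈x*y _ _)))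

    -‿homo : ∀ i → ⟦ ℤ.- i ⟧ℤ ≈ - ⟦ i ⟧ℤ
    -‿homo (+ zero)  = sym -0#≈0#
    -‿homo (+ suc n) = refl
    -‿homo -[1+ n ]  = sym (-‿involutive _)

  ℤ-embedding : ℤ.+-*-rawRing -Raw-AlmostCommutative⟶ fromCommutativeRing R
  ℤ-embedding = record
    { ⟦_⟧    = ⟦_⟧ℤ
    ; +-homo = +-homo
    ; *-homo = *-homo
    ; -‿homo = -‿homo
    ; 0-homo = refl
    ; 1-homo = refl
    }

  _≟-embedded_ : WeaklyDecidable (Induced-equivalence ℤ-embedding)
  i ≟-embedded j with i ℤ.≟ j
  ... | yes i≡j = just (reflexive (cong ⟦_⟧ℤ i≡j))
  ... | no _    = nothing

  open import Algebra.Solver.Ring ℤ.+-*-rawRing (fromCommutativeRing R) ℤ-embedding _≟-embedded_ public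
    using (solve; _:=_; _:+_; _:*_; _:-_; :-_; con)

ℤ-bidirectional-induction : ∀ {a} (P : ℤ → Set a) → P (+ 0) →
  (∀ i → P i → P (i +ℤ + 1)) → (∀ i → P (i +ℤ + 1) → P i) → ∀ i → P i
ℤ-bidirectional-induction P P0 up down = go
  where
  go : ∀ i → P i
  go (+ zero)     = P0
  go (+ suc n)    = subst P (cong +_ (ℕ.+-comm n 1)) (up (+ n) (go (+ n)))
  go -[1+ zero ]  = down -[1+ 0 ] P0
  go -[1+ suc n ] = down -[1+ suc n ] (go -[1+ n ])

module HoradamSequences {c ℓ} (F : Field c ℓ) where
  open Field F
  open IntegerCoefficientSolver commutativeRing
  open import Data.Product using (_×_; _,_; proj₁)
  open import Relation.Binary.Reasoning.Setoid setoid

  ≈-cong : ∀ (f : ℤ → Carrier) {i j} → i ≡ j → f i ≈ f j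
  ≈-cong f i≡j = reflexive (cong f i≡j)

  ⁻¹-inverseˡ : ∀ {x} → ¬ (x ≈ 0#) → x ⁻¹ * x ≈ 1#
  ⁻¹-inverseˡ {x} x≉0 = trans (*-comm (x ⁻¹) x) (⁻¹-inverse x x≉0)

  /-*-cancel : ∀ {x} y → ¬ (x ≈ 0#) → y / x * x ≈ y
  /-*-cancel {x} y x≉0 = begin
    y * x ⁻¹ * x      ≈⟨ *-assoc y (x ⁻¹) x ⟩
    y * (x ⁻¹ * x)    ≈⟨ *-congˡ (⁻¹-inverseˡ x≉0) ⟩
    y * 1#            ≈⟨ *-identityʳ y ⟩
    y                 ∎

  *-cancelˡ : ∀ {x y z} → ¬ (x ≈ 0#) → x * y ≈ x * z → y ≈ z
  *-cancelˡ {x} {y} {z} x≉0 xy≈xz = begin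
    y                 ≈⟨ x⁻¹[xt]≈t y ⟨
    x ⁻¹ * (x * y)    ≈⟨ *-congˡ xy≈xz ⟩
    x ⁻¹ * (x * z)    ≈⟨ x⁻¹[xt]≈t z ⟩
    z                 ∎
    where
    x⁻¹[xt]≈t : ∀ t → x ⁻¹ * (x * t) ≈ t
    x⁻¹[xt]≈t t = trans (sym (*-assoc _ _ _)) (trans (*-congʳ (⁻¹-inverseˡ x≉0)) (*-identityˡ t))

  *-≉0 : ∀ {x y} → ¬ (x ≈ 0#) → ¬ (y ≈ 0#) → ¬ (x * y ≈ 0#)
  *-≉0 {x} x≉0 y≉0 xy≈0 = y≉0 (*-cancelˡ x≉0 (trans xy≈0 (sym (zeroʳ x))))

  sumTo-cong : ∀ k {f g : ℕ → Carrier} → (∀ j → f j ≈ g j) → sumTo k f ≈ sumTo k g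
  sumTo-cong zero    f≈g = f≈g 0
  sumTo-cong (suc k) f≈g = +-cong (sumTo-cong k f≈g) (f≈g (suc k))

  Recurrent : Carrier → Carrier → (ℤ → Carrier) → Set ℓ
  Recurrent p q f = ∀ i → f (i +ℤ + 2) ≈ p * f (i +ℤ + 1) - q * f i

  module _ {p q : Carrier} where

    recurrent-shift : ∀ {f} k → Recurrent p q f → Recurrent p q (λ i → f (i +ℤ k))
    recurrent-shift {f} k rec i = begin
      f ((i +ℤ + 2) +ℤ k)                        ≡⟨ cong f (xy∙z≈xz∙y i (+ 2) k) ⟩
      f ((i +ℤ k) +ℤ + 2)                        ≈⟨ rec (i +ℤ k) ⟩
      p * f ((i +ℤ k) +ℤ + 1) - q * f (i +ℤ k)
        ≡⟨ cong (λ j → p * f j - q * f (i +ℤ k)) (xy∙z≈xz∙y i k (+ 1)) ⟩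
      p * f ((i +ℤ + 1) +ℤ k) - q * f (i +ℤ k)   ∎

    recurrent-linear : ∀ α β {f g} → Recurrent p q f → Recurrent p q g →
                       Recurrent p q (λ i → α * f i + β * g i)
    recurrent-linear α β {f} {g} recf recg i = begin
      α * f (i +ℤ + 2) + β * g (i +ℤ + 2)
        ≈⟨ +-cong (*-congˡ (recf i)) (*-congˡ (recg i)) ⟩
      α * (p * f (i +ℤ + 1) - q * f i) + β * (p * g (i +ℤ + 1) - q * g i)
        ≈⟨ solve 8 (λ α β p q f₁ f₀ g₁ g₀ →
             α :* (p :* f₁ :- q :* f₀) :+ β :* (p :* g₁ :- q :* g₀)
             := p :* (α :* f₁ :+ β :* g₁) :- q :* (α :* f₀ :+ β :* g₀))
           refl α β p q (f (i +ℤ + 1)) (f i) (g (i +ℤ + 1)) (g i) ⟩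
      p * (α * f (i +ℤ + 1) + β * g (i +ℤ + 1)) - q * (α * f i + β * g i) ∎

    recurrent-backward : ∀ {f} → Recurrent p q f → ∀ i → q * f i ≈ p * f (i +ℤ + 1) - f (i +ℤ + 2)
    recurrent-backward {f} rec i = begin
      q * f i
        ≈⟨ solve 3 (λ p y x → y := p :* x :- (p :* x :- y)) refl p (q * f i) (f (i +ℤ + 1)) ⟩
      p * f (i +ℤ + 1) - (p * f (i +ℤ + 1) - q * f i) ≈⟨ +-congˡ (-‿cong (rec i)) ⟨
      p * f (i +ℤ + 1) - f (i +ℤ + 2)                 ∎

    recurrent-unique : ¬ (q ≈ 0#) → ∀ {f g} → Recurrent p q f → Recurrent p q g →
                       f (+ 0) ≈ g (+ 0) → f (+ 1) ≈ g (+ 1) → ∀ i → f i ≈ g i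
    recurrent-unique q≉0 {f} {g} recf recg f₀≈g₀ f₁≈g₁ i =
      proj₁ (ℤ-bidirectional-induction AgreeAt (f₀≈g₀ , f₁≈g₁) up down i)
      where
      AgreeAt : ℤ → Set ℓ
      AgreeAt i = f i ≈ g i × f (i +ℤ + 1) ≈ g (i +ℤ + 1)

      [i+1]+1≡i+2 : ∀ i → (i +ℤ + 1) +ℤ + 1 ≡ i +ℤ + 2
      [i+1]+1≡i+2 i = ℤ.+-assoc i (+ 1) (+ 1)

      up : ∀ i → AgreeAt i → AgreeAt (i +ℤ + 1)
      up i (eq₀ , eq₁) = eq₁ , (begin
        f ((i +ℤ + 1) +ℤ + 1)              ≡⟨ cong f ([i+1]+1≡i+2 i) ⟩
        f (i +ℤ + 2)                       ≈⟨ recf i ⟩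
        p * f (i +ℤ + 1) - q * f i         ≈⟨ +-cong (*-congˡ eq₁) (-‿cong (*-congˡ eq₀)) ⟩
        p * g (i +ℤ + 1) - q * g i         ≈⟨ recg i ⟨
        g (i +ℤ + 2)                       ≡⟨ cong g ([i+1]+1≡i+2 i) ⟨
        g ((i +ℤ + 1) +ℤ + 1)              ∎)

      down : ∀ i → AgreeAt (i +ℤ + 1) → AgreeAt i
      down i (eq₁ , eq₂) = *-cancelˡ q≉0 (begin
        q * f i                             ≈⟨ recurrent-backward recf i ⟩
        p * f (i +ℤ + 1) - f (i +ℤ + 2)     ≈⟨ +-cong (*-congˡ eq₁) (-‿cong eq₂′) ⟩
        p * g (i +ℤ + 1) - g (i +ℤ + 2)     ≈⟨ recurrent-backward recg i ⟨
        q * g i                             ∎) , eq₁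
        where
        eq₂′ : f (i +ℤ + 2) ≈ g (i +ℤ + 2)
        eq₂′ = trans (sym (≈-cong f ([i+1]+1≡i+2 i))) (trans eq₂ (≈-cong g ([i+1]+1≡i+2 i)))

    backward-step-inverse : ¬ (q ≈ 0#) → ∀ x y → y ≈ p * x - q * ((p * x - y) / q)
    backward-step-inverse q≉0 x y = begin
      y                              ≈⟨ solve 3 (λ p x y → y := p :* x :- (p :* x :- y)) refl p x y ⟩
      p * x - (p * x - y)            ≈⟨ +-congˡ (-‿cong (trans (*-comm q _) (/-*-cancel (p * x - y) q≉0))) ⟨
      p * x - q * ((p * x - y) / q)  ∎

    -- The clauses are split so that the indices i + 1 and i + 2 compute to constructor form
    -- and both sides unfold to one defining step of w.
    w-recurrent : ¬ (q ≈ 0#) → ∀ a b → Recurrent p q (w a b p q)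
    w-recurrent q≉0 a b (+ n) rewrite ℕ.+-comm n 2 | ℕ.+-comm n 1 = refl
    w-recurrent q≉0 a b -[1+ zero ]        = backward-step-inverse q≉0 _ _
    w-recurrent q≉0 a b -[1+ suc zero ]    = backward-step-inverse q≉0 _ _
    w-recurrent q≉0 a b -[1+ suc (suc _) ] = backward-step-inverse q≉0 _ _

    u₋₁≈0 : u p q -[1+ 0 ] ≈ 0#
    u₋₁≈0 = begin
      (p * 1# - p) * q ⁻¹  ≈⟨ *-congʳ (solve 1 (λ p → p :* con (+ 1) :- p := con (+ 0)) refl p) ⟩
      0# * q ⁻¹            ≈⟨ zeroˡ (q ⁻¹) ⟩
      0#                   ∎

    w-+ : ¬ (q ≈ 0#) → ∀ a b m n →
          w a b p q (m +ℤ n) ≈ u p q m * w a b p q n - q * u p q (m -ℤ + 1) * w a b p q (n -ℤ + 1)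
    w-+ q≉0 a b m n = begin
      W (m +ℤ n)                          ≈⟨ recurrent-unique q≉0 recW recG W₀ W₁ m ⟩
      W n * U m + - (q * W′) * U (m -ℤ + 1) ≈⟨ solve 5 (λ Wn Um q W′ U′ →
                                                  Wn :* Um :+ :- (q :* W′) :* U′ := Um :* Wn :- q :* U′ :* W′)
                                               refl (W n) (U m) q W′ (U (m -ℤ + 1)) ⟩
      U m * W n - q * U (m -ℤ + 1) * W′     ∎
      where
      W U : ℤ → Carrier
      W = w a b p q
      U = u p q
      W′ : Carrier
      W′ = W (n -ℤ + 1)

      recW : Recurrent p q (λ i → W (i +ℤ n))
      recW = recurrent-shift n (w-recurrent q≉0 a b)

      recU : Recurrent p q U
      recU = w-recurrent q≉0 1# p

      recG : Recurrent p q (λ i → W n * U i + - (q * W′) * U (i -ℤ + 1))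
      recG = recurrent-linear (W n) (- (q * W′)) recU (recurrent-shift -[1+ 0 ] recU)

      1+i≡[i-1]+2 : ∀ i → + 1 +ℤ i ≡ (i -ℤ + 1) +ℤ + 2
      1+i≡[i-1]+2 = solve-∀
      [i-1]+1≡i : ∀ i → (i -ℤ + 1) +ℤ + 1 ≡ i
      [i-1]+1≡i = solve-∀

      W₀ : W (+ 0 +ℤ n) ≈ W n * 1# + - (q * W′) * U -[1+ 0 ]
      W₀ = begin
        W (+ 0 +ℤ n)                      ≡⟨ cong W (ℤ.+-identityˡ n) ⟩
        W n
          ≈⟨ solve 2 (λ Wn c → Wn := Wn :* con (+ 1) :+ c :* con (+ 0)) refl (W n) (- (q * W′)) ⟩
        W n * 1# + - (q * W′) * 0#        ≈⟨ +-congˡ (*-congˡ u₋₁≈0) ⟨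
        W n * 1# + - (q * W′) * U -[1+ 0 ] ∎

      W₁ : W (+ 1 +ℤ n) ≈ W n * p + - (q * W′) * 1#
      W₁ = begin
        W (+ 1 +ℤ n)                                ≡⟨ cong W (1+i≡[i-1]+2 n) ⟩
        W ((n -ℤ + 1) +ℤ + 2)                       ≈⟨ w-recurrent q≉0 a b (n -ℤ + 1) ⟩
        p * W ((n -ℤ + 1) +ℤ + 1) - q * W′          ≡⟨ cong (λ i → p * W i - q * W′) ([i-1]+1≡i n) ⟩
        p * W n - q * W′
          ≈⟨ solve 4 (λ p Wn q W′ → p :* Wn :- q :* W′ := Wn :* p :+ :- (q :* W′) :* con (+ 1))
                   refl p (W n) q W′ ⟩
        W n * p + - (q * W′) * 1#                   ∎

    sum-identity : ¬ (q ≈ 0#) → ∀ a b r x → x * (q * w a b p q (r -ℤ + 1)) ≈ w a b p q r →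
      ∀ k m → sumTo k (λ j → pow x j * w a b p q (((m +ℤ r) -ℤ + k) +ℤ + j))
              ≈ pow x k * u p q m * w a b p q r - q * u p q ((m -ℤ + k) -ℤ + 1) * w a b p q (r -ℤ + 1)
    sum-identity q≉0 a b r x x[qW′]≈Wr = go
      where
      W U : ℤ → Carrier
      W = w a b p q
      U = u p q
      W′ : Carrier
      W′ = W (r -ℤ + 1)

      [i+j]-0+0≡i+j : ∀ i j → ((i +ℤ j) -ℤ + 0) +ℤ + 0 ≡ i +ℤ j
      [i+j]-0+0≡i+j = solve-∀
      i-0-1≡i-1 : ∀ i → (i -ℤ + 0) -ℤ + 1 ≡ i -ℤ + 1
      i-0-1≡i-1 = solve-∀
      [i+j]-[1+k]+l≡[i-1+j]-k+l :
        ∀ i j k l → ((i +ℤ j) -ℤ (+ 1 +ℤ k)) +ℤ l ≡ (((i -ℤ + 1) +ℤ j) -ℤ k) +ℤ l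
      [i+j]-[1+k]+l≡[i-1+j]-k+l = solve-∀
      [i+j]-k+k≡i+j : ∀ i j k → ((i +ℤ j) -ℤ k) +ℤ k ≡ i +ℤ j
      [i+j]-k+k≡i+j = solve-∀
      [i-1-k]-1≡[i-[1+k]]-1 : ∀ i k → ((i -ℤ + 1) -ℤ k) -ℤ + 1 ≡ (i -ℤ (+ 1 +ℤ k)) -ℤ + 1
      [i-1-k]-1≡[i-[1+k]]-1 = solve-∀

      telescope : ∀ X A B C → (X * A * W r - q * C * W′) + X * x * (B * W r - q * A * W′)
                              ≈ X * x * B * W r - q * C * W′
      telescope X A B C = begin
        (X * A * W r - q * C * W′) + X * x * (B * W r - q * A * W′)
          ≈⟨ +-congʳ (+-congʳ (*-congˡ x[qW′]≈Wr)) ⟨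
        (X * A * (x * (q * W′)) - q * C * W′) + X * x * (B * W r - q * A * W′)
          ≈⟨ solve 8 (λ X A B C x q Wr W′ →
               (X :* A :* (x :* (q :* W′)) :- q :* C :* W′) :+ X :* x :* (B :* Wr :- q :* A :* W′)
               := X :* x :* B :* Wr :- q :* C :* W′)
             refl X A B C x q (W r) W′ ⟩
        X * x * B * W r - q * C * W′ ∎

      go : ∀ k m → sumTo k (λ j → pow x j * W (((m +ℤ r) -ℤ + k) +ℤ + j))
                   ≈ pow x k * U m * W r - q * U ((m -ℤ + k) -ℤ + 1) * W′
      go zero m = begin
        1# * W (((m +ℤ r) -ℤ + 0) +ℤ + 0)
          ≡⟨ cong (λ i → 1# * W i) ([i+j]-0+0≡i+j m r) ⟩
        1# * W (m +ℤ r)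
          ≈⟨ *-congˡ (w-+ q≉0 a b m r) ⟩
        1# * (U m * W r - q * U (m -ℤ + 1) * W′)
          ≈⟨ solve 5 (λ Um Wr q U′ W′ → con (+ 1) :* (Um :* Wr :- q :* U′ :* W′)
                                         := con (+ 1) :* Um :* Wr :- q :* U′ :* W′)
                   refl (U m) (W r) q (U (m -ℤ + 1)) W′ ⟩
        1# * U m * W r - q * U (m -ℤ + 1) * W′
          ≡⟨ cong (λ i → 1# * U m * W r - q * U i * W′) (i-0-1≡i-1 m) ⟨
        1# * U m * W r - q * U ((m -ℤ + 0) -ℤ + 1) * W′ ∎
      go (suc k) m = begin
        sumTo k (λ j → pow x j * W (((m +ℤ r) -ℤ + suc k) +ℤ + j))
          + pow x k * x * W (((m +ℤ r) -ℤ + suc k) +ℤ + suc k)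
          ≈⟨ +-cong (sumTo-cong k (λ j → *-congˡ (≈-cong W ([i+j]-[1+k]+l≡[i-1+j]-k+l m r (+ k) (+ j)))))
                    (*-congˡ (≈-cong W ([i+j]-k+k≡i+j m r (+ suc k)))) ⟩
        sumTo k (λ j → pow x j * W ((((m -ℤ + 1) +ℤ r) -ℤ + k) +ℤ + j)) + pow x k * x * W (m +ℤ r)
          ≈⟨ +-cong (go k (m -ℤ + 1)) (*-congˡ (w-+ q≉0 a b m r)) ⟩
        (pow x k * U (m -ℤ + 1) * W r - q * U (((m -ℤ + 1) -ℤ + k) -ℤ + 1) * W′)
          + pow x k * x * (U m * W r - q * U (m -ℤ + 1) * W′)
          ≈⟨ telescope (pow x k) (U (m -ℤ + 1)) (U m) (U (((m -ℤ + 1) -ℤ + k) -ℤ + 1)) ⟩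
        pow x k * x * U m * W r - q * U (((m -ℤ + 1) -ℤ + k) -ℤ + 1) * W′
          ≡⟨ cong (λ i → pow x (suc k) * U m * W r - q * U i * W′) ([i-1-k]-1≡[i-[1+k]]-1 m (+ k)) ⟩
        pow x (suc k) * U m * W r - q * U ((m -ℤ + suc k) -ℤ + 1) * W′ ∎

theorem2 : ∀ {c ℓ} (F : Field c ℓ) → let open Field F in
  (a b p q : Carrier) → ¬ (p ≈ 0#) → ¬ (q ≈ 0#) →
  (m : ℤ) (k : ℕ) (r : ℤ) → ¬ (w a b p q (r -ℤ + 1) ≈ 0#) →
  sumTo k (λ j → pow (w a b p q r / (q * w a b p q (r -ℤ + 1))) j
                  * w a b p q (((m +ℤ r) -ℤ + k) +ℤ + j))
    ≈ pow (w a b p q r / (q * w a b p q (r -ℤ + 1))) k * u p q m * w a b p q r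
      - q * u p q ((m -ℤ + k) -ℤ + 1) * w a b p q (r -ℤ + 1)
theorem2 F a b p q _ q≉0 m k r w[r-1]≉0 =
  sum-identity q≉0 a b r (W r / q·W′) (/-*-cancel (W r) q·W′≉0) k m
  where
  open Field F
  open HoradamSequences F

  W : ℤ → Carrier
  W = w a b p q

  q·W′ : Carrier
  q·W′ = q * W (r -ℤ + 1)

  q·W′≉0 : ¬ (q·W′ ≈ 0#)
  q·W′≉0 = *-≉0 q≉0 w[r-1]≉0
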